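{- Let $G=(V,E)$ be a finite, simple, connected undirected graph in which every edge carries exactly one label from a finite label set $L$, and let $H_i$ be a hedge of $G$. Then $$\sum_{v\in V(G)}d_L(v)\leq \sum_{v\in V(G/H_i)}d_L(v)+\sum_{v\in V(H_i)}d_L(v)-\mathrm{span}(H_i)\,\bigl(\delta_L(V(G))-1\bigr),$$ where $d_L$ is computed in $G$ for vertices of $G$ and in $G/H_i$ for vertices of $G/H_i$.
   Context: For each label $\ell_i$, the hedge $H_i$ is the set of edges carrying label $\ell_i$. $V(H_i)$ is the set of vertices incident with an edge of $H_i$, and $\mathrm{span}(H_i)$ is the number of connected components of $(V(H_i),H_i)$. $G/H_i$ is the graph obtained from $G$ in the following steps: 1. Contract every edge of $H_i$. 2. Delete the resulting loops with label $\ell_i$. Loops with other labels are kept. 3. Merge parallel edges with the same label between two vertices into one, and merge loops with the same label at a vertex into one. All remaining edges keep their labels. The label degree $d_L(v)$ of a vertex is the number of distinct labels on edges, including loops, incident with it. $\delta_L(V(G))$ is the minimum label degree over vertices of $G$. -}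

module Defs where

open import Data.Nat using (ℕ; zero; suc; _+_; _⊔_; _⊓_)
open import Data.Bool using (Bool; true; false; _∧_; _∨_; not; if_then_else_; T)
open import Data.Fin using (Fin; zero; suc; _≟_)
open import Data.Product using (_×_; Σ)
open import Relation.Nullary.Decidable using (⌊_⌋)
open import Relation.Binary.PropositionalEquality using (_≡_)
open import Relation.Binary.Construct.Closure.ReflexiveTransitive using (Star)
open import Function using (Surjective)

anyF : ∀ {n} → (Fin n → Bool) → Bool
anyF {zero}  p = false
anyF {suc n} p = p zero ∨ anyF (λ j → p (suc j))

sumF : ∀ {n} → (Fin n → ℕ) → ℕ
sumF {zero}  f = 0
sumF {suc n} f = f zero + sumF (λ j → f (suc j))

countF : ∀ {n} → (Fin n → Bool) → ℕ
countF p = sumF (λ j → if p j then 1 else 0)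

sumOverF : ∀ {n} → (Fin n → Bool) → (Fin n → ℕ) → ℕ
sumOverF p f = sumF (λ j → if p j then f j else 0)

minF : ∀ {n} → (Fin (suc n) → ℕ) → ℕ
minF {zero}  f = f zero
minF {suc n} f = f zero ⊓ minF (λ j → f (suc j))

-- Edge-labelled multigraphs (with loops) given by their labelled edge
-- relation:  E a b l = true  iff there is an edge (or loop if a = b)
-- with label l between a and b.  Parallel edges with the same label are
-- automatically merged.

LRel : ℕ → ℕ → Set
LRel m k = Fin m → Fin m → Fin k → Bool

labelDeg : ∀ {m k} → LRel m k → Fin m → ℕ
labelDeg E a = countF (λ l → anyF (λ b → E a b l))

record LGraph (n k : ℕ) : Set where
  field
    adj      : Fin n → Fin n → Bool
    lab      : Fin n → Fin n → Fin k    -- label of edge uv (meaningful when adj u v)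
    adj-sym  : ∀ u v → adj u v ≡ adj v u
    adj-irr  : ∀ u → adj u u ≡ false
    lab-sym  : ∀ u v → T (adj u v) → lab u v ≡ lab v u

module _ {n k : ℕ} (G : LGraph n k) where
  open LGraph G

  edgeRel : LRel n k
  edgeRel u v l = adj u v ∧ ⌊ lab u v ≟ l ⌋

  dL : Fin n → ℕ
  dL = labelDeg edgeRel

  Adj : Fin n → Fin n → Set
  Adj u v = T (adj u v)

  Connected : Set
  Connected = ∀ u v → Star Adj u v

  HEdge : Fin k → Fin n → Fin n → Set
  HEdge i u v = T (edgeRel u v i)

  inVH : Fin k → Fin n → Bool
  inVH i v = anyF (λ w → edgeRel v w i)

  -- c : Fin n → Fin m is a (surjective) labelling of the classes of the
  -- equivalence relation "joined by a path of H_i-edges"; i.e. Fin m is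
  -- the vertex set of G/H_i and c the contraction map.
  IsContraction : (i : Fin k) (m : ℕ) → (Fin n → Fin m) → Set
  IsContraction i m c =
    Surjective _≡_ _≡_ c ×
    (∀ u v → (c u ≡ c v → Star (HEdge i) u v) × (Star (HEdge i) u v → c u ≡ c v))

  -- labelled edge relation of G/H_i: edges of G mapped through c,
  -- loops with label i deleted (every H_i-edge becomes such a loop),
  -- other loops kept, same-label parallel edges / loops merged.
  quotRel : (i : Fin k) {m : ℕ} → (Fin n → Fin m) → LRel m k
  quotRel i c a b l =
    not ⌊ l ≟ i ⌋ ∧
    anyF (λ u → anyF (λ v → ⌊ c u ≟ a ⌋ ∧ ⌊ c v ≟ b ⌋ ∧ edgeRel u v l))

  dLquot : (i : Fin k) {m : ℕ} → (Fin n → Fin m) → Fin m → ℕ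
  dLquot i c = labelDeg (quotRel i c)

  -- span(H_i): number of components of (V(H_i), H_i) = number of classes
  -- of the contraction containing a vertex of V(H_i)
  spanH : (i : Fin k) {m : ℕ} → (Fin n → Fin m) → ℕ
  spanH i {m} c = countF (λ a → anyF (λ v → ⌊ c v ≟ a ⌋ ∧ inVH i v))

δL : ∀ {n k} → LGraph (suc n) k → ℕ
δL G = minF (dL G)

-- Sort the classes of the contraction c into those meeting V(H_i) (there are span(H_i) of
-- them) and the rest.  A vertex w outside V(H_i) has no H_i-edge, so it is alone in its
-- class and keeps all its labels there: d_L(w) ≤ d_L(c w).  A vertex v of V(H_i) can only
-- lose the label i, so its class has label degree at least d_L(v) - 1 ≥ δ_L - 1.  Summing
-- over the classes bounds the degrees of the vertices outside V(H_i) together with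
-- span(H_i)(δ_L - 1) by the degree sum of G/H_i; the degrees inside V(H_i) are added on
-- both sides.
module Submission where

open import Defs
open import Data.Nat using (ℕ; suc)
open import Data.Fin using (Fin)
open import Data.Integer using (ℤ; +_; _+_; _-_; _*_; _≤_)

import Data.Nat as ℕ
import Data.Nat.Properties as ℕ
import Data.Integer.Properties as ℤ
open import Data.Nat using (zero; _∸_; z≤n)
open import Data.Integer using (-≤+; +≤+; _⊖_)
open import Data.Fin using (zero; suc; _≟_)
open import Data.Bool using (Bool; true; false; _∧_; not; if_then_else_; T)
open import Data.Bool.Properties using (T-∧)
open import Data.Product using (∃; _,_; proj₁; proj₂)
open import Data.Empty using (⊥-elim)
open import Data.Unit using (tt)
open import Function using (_∘_)
open import Function.Bundles using (Equivalence)
open import Relation.Nullary using (¬_; yes; no)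
open import Relation.Nullary.Decidable using (⌊_⌋; ⌊⌋-map′; toWitness; fromWitness; fromWitnessFalse)
open import Relation.Binary.PropositionalEquality
open import Relation.Binary.Construct.Closure.ReflexiveTransitive using (ε; _◅_)
open import Algebra.Properties.CommutativeSemigroup ℕ.+-commutativeSemigroup using (interchange)

open Equivalence using (to; from)

T-not⁻ : ∀ {b} → T (not b) → ¬ T b
T-not⁻ {false} _ ()

anyF⁺ : ∀ {n} (p : Fin n → Bool) j → T (p j) → T (anyF p)
anyF⁺ p zero    pj with p zero
... | true = tt
anyF⁺ p (suc j) pj with p zero
... | true  = tt
... | false = anyF⁺ (p ∘ suc) j pj

anyF⁻ : ∀ {n} (p : Fin n → Bool) → T (anyF p) → ∃ λ j → T (p j)
anyF⁻ {suc n} p t with p zero in eq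
... | true  = zero , subst T (sym eq) tt
... | false with anyF⁻ (p ∘ suc) t
...   | j , pj = suc j , pj

if-mono : ∀ {b b′} x → (T b → T b′) → (if b then x else 0) ℕ.≤ (if b′ then x else 0)
if-mono {false}         x _  = z≤n
if-mono {true} {true}   x _  = ℕ.≤-refl
if-mono {true} {false}  x b⇒ = ⊥-elim (b⇒ tt)

sumF-cong : ∀ {n} {f g : Fin n → ℕ} → (∀ j → f j ≡ g j) → sumF f ≡ sumF g
sumF-cong {zero}  f≗g = refl
sumF-cong {suc n} f≗g = cong₂ ℕ._+_ (f≗g zero) (sumF-cong (f≗g ∘ suc))

sumF-mono : ∀ {n} {f g : Fin n → ℕ} → (∀ j → f j ℕ.≤ g j) → sumF f ℕ.≤ sumF g
sumF-mono {zero}  f≤g = z≤n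
sumF-mono {suc n} f≤g = ℕ.+-mono-≤ (f≤g zero) (sumF-mono (f≤g ∘ suc))

sumF-zero : ∀ n → sumF {n} (λ _ → 0) ≡ 0
sumF-zero zero    = refl
sumF-zero (suc n) = sumF-zero n

sumF-+ : ∀ {n} (f g : Fin n → ℕ) → sumF (λ j → f j ℕ.+ g j) ≡ sumF f ℕ.+ sumF g
sumF-+ {zero}  f g = refl
sumF-+ {suc n} f g =
  trans (cong (f zero ℕ.+ g zero ℕ.+_) (sumF-+ (f ∘ suc) (g ∘ suc)))
        (interchange (f zero) (g zero) (sumF (f ∘ suc)) (sumF (g ∘ suc)))

sumF-comm : ∀ {n m} (f : Fin n → Fin m → ℕ) →
  sumF (λ a → sumF (f a)) ≡ sumF (λ b → sumF (λ a → f a b))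
sumF-comm {zero}  {m} f = sym (sumF-zero m)
sumF-comm {suc n}     f =
  trans (cong (sumF (f zero) ℕ.+_) (sumF-comm (f ∘ suc)))
        (sym (sumF-+ (f zero) (λ b → sumF (λ a → f (suc a) b))))

sumOverF-at : ∀ {n} (b : Fin n) (f : Fin n → ℕ) → sumOverF (λ j → ⌊ b ≟ j ⌋) f ≡ f b
sumOverF-at {suc n} zero    f = trans (cong (f zero ℕ.+_) (sumF-zero n)) (ℕ.+-identityʳ (f zero))
sumOverF-at {suc n} (suc b) f =
  trans (sumF-cong (λ j → cong (λ t → if t then f (suc j) else 0) (⌊⌋-map′ _ _ (b ≟ j))))
        (sumOverF-at b (f ∘ suc))

sumOverF-const : ∀ {n} (p : Fin n → Bool) x → sumOverF p (λ _ → x) ≡ countF p ℕ.* x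
sumOverF-const {zero}  p x = refl
sumOverF-const {suc n} p x with p zero
... | true  = cong (x ℕ.+_) (sumOverF-const (p ∘ suc) x)
... | false = sumOverF-const (p ∘ suc) x

sumOverF-mono-⊆ : ∀ {n} {p q : Fin n → Bool} (f : Fin n → ℕ) →
  (∀ j → T (p j) → T (q j)) → sumOverF p f ℕ.≤ sumOverF q f
sumOverF-mono-⊆ f p⊆q = sumF-mono (λ j → if-mono (f j) (p⊆q j))

sumOverF-∅ : ∀ {n} {p : Fin n → Bool} (f : Fin n → ℕ) → (∀ j → ¬ T (p j)) → sumOverF p f ≡ 0
sumOverF-∅ {n} f p∅ =
  ℕ.n≤0⇒n≡0 (ℕ.≤-trans (sumOverF-mono-⊆ f p∅) (ℕ.≤-reflexive (sumF-zero n)))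

sumF-split : ∀ {n} (p : Fin n → Bool) (f : Fin n → ℕ) →
  sumF f ≡ sumOverF p f ℕ.+ sumOverF (not ∘ p) f
sumF-split p f =
  trans (sumF-cong (λ j → split (p j) (f j)))
        (sumF-+ (λ j → if p j then f j else 0) (λ j → if not (p j) then f j else 0))
  where
  split : ∀ b x → x ≡ (if b then x else 0) ℕ.+ (if not b then x else 0)
  split true  x = sym (ℕ.+-identityʳ x)
  split false x = refl

sumOverF-fibres : ∀ {n m} (c : Fin n → Fin m) (p : Fin n → Bool) (f : Fin n → ℕ) →
  sumOverF p f ≡ sumF (λ a → sumOverF (λ w → p w ∧ ⌊ c w ≟ a ⌋) f)
sumOverF-fibres {m = m} c p f =
  trans (sym (sumF-cong fibre)) (sumF-comm (λ w a → if p w ∧ ⌊ c w ≟ a ⌋ then f w else 0))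
  where
  fibre : ∀ w → sumF (λ a → if p w ∧ ⌊ c w ≟ a ⌋ then f w else 0) ≡ (if p w then f w else 0)
  fibre w with p w
  ... | true  = sumOverF-at (c w) (λ _ → f w)
  ... | false = sumF-zero m

countF-mono : ∀ {n} {p q : Fin n → Bool} → (∀ j → T (p j) → T (q j)) → countF p ℕ.≤ countF q
countF-mono = sumOverF-mono-⊆ (λ _ → 1)

countF-≤-suc : ∀ {n} {p q : Fin n → Bool} (x : Fin n) →
  (∀ j → j ≢ x → T (p j) → T (q j)) → countF p ℕ.≤ countF q ℕ.+ 1
countF-≤-suc {p = p} {q} x p⊆q =
  ℕ.≤-trans (sumF-mono bound)
    (ℕ.≤-reflexive (trans (sumF-+ (λ j → if q j then 1 else 0) (λ j → if ⌊ x ≟ j ⌋ then 1 else 0))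
                          (cong (countF q ℕ.+_) (sumOverF-at x (λ _ → 1)))))
  where
  bound : ∀ j → (if p j then 1 else 0) ℕ.≤ (if q j then 1 else 0) ℕ.+ (if ⌊ x ≟ j ⌋ then 1 else 0)
  bound j with x ≟ j
  ... | yes _ = ℕ.≤-trans (if-mono 1 (λ _ → tt)) (ℕ.m≤n+m 1 _)
  ... | no x≢j = ℕ.≤-trans (if-mono 1 (p⊆q j (x≢j ∘ sym))) (ℕ.m≤m+n _ 0)

minF-≤ : ∀ {n} (f : Fin (suc n) → ℕ) j → minF f ℕ.≤ f j
minF-≤ {zero}  f zero    = ℕ.≤-refl
minF-≤ {suc n} f zero    = ℕ.m⊓n≤m _ _
minF-≤ {suc n} f (suc j) = ℕ.≤-trans (ℕ.m⊓n≤n _ _) (minF-≤ (f ∘ suc) j)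

-- Junk value: + d - + 1 is -1 at d = 0, where truncated subtraction gives 0.
-≤∸ : ∀ d → + d - + 1 ≤ + (d ∸ 1)
-≤∸ zero    = -≤+
-≤∸ (suc d) = ℤ.≤-refl

ℕ≤⇒ℤ≤ : ∀ S D V s d → S ℕ.+ s ℕ.* (d ∸ 1) ℕ.≤ D ℕ.+ V →
  + S ≤ + D + + V - + s * (+ d - + 1)
ℕ≤⇒ℤ≤ S D V s d le = begin
  + S                            ≤⟨ +≤+ (ℕ.m+n≤o⇒m≤o∸n S le) ⟩
  + (D ℕ.+ V ∸ X)               ≡⟨ ℤ.⊖-≥ X≤D+V ⟨
  (D ℕ.+ V) ⊖ X                 ≡⟨ ℤ.m-n≡m⊖n (D ℕ.+ V) X ⟨
  + (D ℕ.+ V) - + X             ≡⟨ cong (_- + X) (ℤ.pos-+ D V) ⟩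
  + D + + V - + X                ≤⟨ ℤ.+-monoʳ-≤ (+ D + + V) (ℤ.neg-mono-≤ sX≤X) ⟩
  + D + + V - + s * (+ d - + 1)  ∎
  where
  open ℤ.≤-Reasoning
  X = s ℕ.* (d ∸ 1)
  X≤D+V : X ℕ.≤ D ℕ.+ V
  X≤D+V = ℕ.≤-trans (ℕ.m≤n+m X S) le
  sX≤X : + s * (+ d - + 1) ≤ + X
  sX≤X = ℤ.≤-trans (ℤ.*-monoˡ-≤-nonNeg (+ s) (-≤∸ d)) (ℤ.≤-reflexive (sym (ℤ.pos-* s (d ∸ 1))))

labelsAt : ∀ {m k} → LRel m k → Fin m → Fin k → Bool
labelsAt E a l = anyF (λ b → E a b l)

module _ {n k} (G : LGraph n k) (i : Fin k) {m} (c : Fin n → Fin m) where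

  labelsAt-quot : ∀ v l → l ≢ i → T (labelsAt (edgeRel G) v l) →
    T (labelsAt (quotRel G i c) (c v) l)
  labelsAt-quot v l l≢i vl with anyF⁻ _ vl
  ... | w , vw = anyF⁺ (λ b → quotRel G i c (c v) b l) (c w) (from T-∧ (fromWitnessFalse l≢i ,
                   anyF⁺ _ v (anyF⁺ _ w (from T-∧ (fromWitness {a? = c v ≟ c v} refl ,
                     from T-∧ (fromWitness {a? = c w ≟ c w} refl , vw))))))

  dL≤dLquot+1 : ∀ v → dL G v ℕ.≤ dLquot G i c (c v) ℕ.+ 1
  dL≤dLquot+1 v = countF-≤-suc i (labelsAt-quot v)

  dL≤dLquot : ∀ w → ¬ T (inVH G i w) → dL G w ℕ.≤ dLquot G i c (c w)
  dL≤dLquot w w∉ = countF-mono (λ l wl → labelsAt-quot w l (λ { refl → w∉ wl }) wl)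

  meetsHedge : Fin m → Bool
  meetsHedge a = anyF (λ v → ⌊ c v ≟ a ⌋ ∧ inVH G i v)

  outsideFibre : Fin m → Fin n → Bool
  outsideFibre a w = not (inVH G i w) ∧ ⌊ c w ≟ a ⌋

  module _ (contraction : IsContraction G i m c) (δ : ℕ) (δ≤dL : ∀ v → δ ℕ.≤ dL G v) where

    outside-alone : ∀ {w w′} → ¬ T (inVH G i w) → c w ≡ c w′ → w ≡ w′
    outside-alone w∉ cw≡cw′ with proj₁ (proj₂ contraction _ _) cw≡cw′
    ... | ε      = refl
    ... | e ◅ _  = ⊥-elim (w∉ (anyF⁺ (λ x → edgeRel G _ x i) _ e))

    hedgeClass-bound : ∀ v → T (inVH G i v) →
      δ ∸ 1 ℕ.+ sumOverF (outsideFibre (c v)) (dL G) ℕ.≤ dLquot G i c (c v)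
    hedgeClass-bound v v∈ = begin
      δ ∸ 1 ℕ.+ sumOverF (outsideFibre (c v)) (dL G)  ≡⟨ cong (δ ∸ 1 ℕ.+_) (sumOverF-∅ (dL G) empty) ⟩
      δ ∸ 1 ℕ.+ 0                                     ≡⟨ ℕ.+-identityʳ (δ ∸ 1) ⟩
      δ ∸ 1                                           ≤⟨ ℕ.∸-monoˡ-≤ 1 (δ≤dL v) ⟩
      dL G v ∸ 1                                      ≤⟨ ℕ.m≤n+o⇒m∸n≤o (dL G v) 1
                                                           (ℕ.≤-trans (dL≤dLquot+1 v) (ℕ.≤-reflexive (ℕ.+-comm _ 1))) ⟩
      dLquot G i c (c v)                              ∎
      where
      open ℕ.≤-Reasoning
      empty : ∀ w → ¬ T (outsideFibre (c v) w)
      empty w t with to T-∧ t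
      ... | w∉ , cw≡cv with outside-alone (T-not⁻ w∉) (toWitness cw≡cv)
      ...   | refl = T-not⁻ w∉ v∈

    outsideClass-bound : ∀ w → ¬ T (inVH G i w) →
      sumOverF (outsideFibre (c w)) (dL G) ℕ.≤ dLquot G i c (c w)
    outsideClass-bound w w∉ = begin
      sumOverF (outsideFibre (c w)) (dL G)  ≤⟨ sumOverF-mono-⊆ (dL G) only-w ⟩
      sumOverF (λ j → ⌊ w ≟ j ⌋) (dL G)    ≡⟨ sumOverF-at w (dL G) ⟩
      dL G w                                ≤⟨ dL≤dLquot w w∉ ⟩
      dLquot G i c (c w)                    ∎
      where
      open ℕ.≤-Reasoning
      only-w : ∀ w′ → T (outsideFibre (c w) w′) → T ⌊ w ≟ w′ ⌋
      only-w w′ t with to T-∧ t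
      ... | w′∉ , cw′≡cw = fromWitness (sym (outside-alone (T-not⁻ w′∉) (toWitness cw′≡cw)))

    class-bound : ∀ a →
      (if meetsHedge a then δ ∸ 1 else 0) ℕ.+ sumOverF (outsideFibre a) (dL G) ℕ.≤ dLquot G i c a
    class-bound a with meetsHedge a in meets
    ... | true with anyF⁻ _ (subst T (sym meets) tt)
    ...   | v , t with to T-∧ t
    ...     | cv≡a , v∈ with toWitness {a? = c v ≟ a} cv≡a
    ...       | refl = hedgeClass-bound v v∈
    class-bound a | false with proj₁ contraction a
    ...   | w , cw≡a with cw≡a refl
    ...     | refl = outsideClass-bound w w∉
      where
      w∉ : ¬ T (inVH G i w)
      w∉ w∈ = subst T meets (anyF⁺ _ w (from T-∧ (fromWitness {a? = c w ≟ c w} refl , w∈)))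

    degreeSum-bound : sumF (dL G) ℕ.+ spanH G i c ℕ.* (δ ∸ 1)
                      ℕ.≤ sumF (dLquot G i c) ℕ.+ sumOverF (inVH G i) (dL G)
    degreeSum-bound = begin
      sumF (dL G) ℕ.+ Hedged
        ≡⟨ cong (ℕ._+ Hedged) (sumF-split (inVH G i) (dL G)) ⟩
      Inside ℕ.+ Outside ℕ.+ Hedged
        ≡⟨ ℕ.+-assoc Inside Outside _ ⟩
      Inside ℕ.+ (Outside ℕ.+ Hedged)
        ≡⟨ cong (Inside ℕ.+_) (ℕ.+-comm Outside _) ⟩
      Inside ℕ.+ (Hedged ℕ.+ Outside)
        ≡⟨ cong (Inside ℕ.+_) (cong₂ ℕ._+_ (sym (sumOverF-const meetsHedge (δ ∸ 1)))
                                           (sumOverF-fibres c (not ∘ inVH G i) (dL G))) ⟩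
      Inside ℕ.+ (sumOverF meetsHedge (λ _ → δ ∸ 1) ℕ.+ sumF (λ a → sumOverF (outsideFibre a) (dL G)))
        ≡⟨ cong (Inside ℕ.+_) (sym (sumF-+ (λ a → if meetsHedge a then δ ∸ 1 else 0)
                                            (λ a → sumOverF (outsideFibre a) (dL G)))) ⟩
      Inside ℕ.+ sumF (λ a → (if meetsHedge a then δ ∸ 1 else 0) ℕ.+ sumOverF (outsideFibre a) (dL G))
        ≤⟨ ℕ.+-monoʳ-≤ Inside (sumF-mono class-bound) ⟩
      Inside ℕ.+ sumF (dLquot G i c)
        ≡⟨ ℕ.+-comm Inside _ ⟩
      sumF (dLquot G i c) ℕ.+ Inside ∎
      where
      open ℕ.≤-Reasoning
      Inside = sumOverF (inVH G i) (dL G)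
      Outside = sumOverF (not ∘ inVH G i) (dL G)
      Hedged = spanH G i c ℕ.* (δ ∸ 1)

theorem13 : (n k : ℕ) (G : LGraph (suc n) k) → Connected G →
    (i : Fin k) (m : ℕ) (c : Fin (suc n) → Fin m) → IsContraction G i m c →
    + sumF (dL G)
      ≤ + sumF (dLquot G i c) + + sumOverF (inVH G i) (dL G)
        - + spanH G i c * (+ δL G - + 1)
theorem13 n k G _ i m c contraction =
  ℕ≤⇒ℤ≤ (sumF (dL G)) (sumF (dLquot G i c)) (sumOverF (inVH G i) (dL G)) (spanH G i c) (δL G)
        (degreeSum-bound G i c contraction (δL G) (minF-≤ (dL G)))
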